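{- Any one-pass asymmetric streaming algorithm for wildcard pattern matching requires memory $\Omega(n)$, where $n$ is the size of the input.
   Context: Wildcard pattern matching: given a text $T$ over an alphabet $\Sigma$ and a pattern $P$ over $\Sigma\cup\{?\}$, where the wildcard character $?$ matches any single character of the text, decide whether $P$ matches some (contiguous) substring of $T$ of length $|P|$, i.e., whether there is a position $j$ such that for every $i$, either $P[i]=?$ or $P[i]=T[j+i-1]$. In the asymmetric streaming setting, the text $T$ is available via value queries (random access to any character), while the pattern $P$ arrives as a stream of characters read in a single pass; memory is the amount of storage (in bits) the algorithm maintains, not counting the text. -}

module Defs where

open import Data.Nat using (ℕ; zero; suc; _+_; _*_; _^_; _≤_)
open import Data.Fin using (Fin)
open import Data.Fin.Subset using (Subset; _∈_; ∣_∣)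
open import Data.Maybe using (Maybe; just; nothing)
open import Data.List using (List; []; _∷_; foldl; drop; length)
open import Data.Bool using (Bool; true)
open import Data.Product using (Σ; ∃; ∃-syntax; _×_; _,_)
open import Data.Sum using (_⊎_)
open import Data.Unit using (⊤)
open import Data.Empty using (⊥)
open import Function.Bundles using (_⇔_)
open import Relation.Binary.PropositionalEquality using (_≡_)

-- Alphabet Σ = Fin k.  Texts are words over Σ; patterns are words over
-- Σ ∪ {?}, where the wildcard ? is represented by 'nothing'.
Text : ℕ → Set
Text k = List (Fin k)

Pattern : ℕ → Set
Pattern k = List (Maybe (Fin k))

CharMatch : ∀ {k} → Maybe (Fin k) → Fin k → Set
CharMatch p t = (p ≡ nothing) ⊎ (p ≡ just t)

PrefixMatch : ∀ {k} → Pattern k → Text k → Set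
PrefixMatch []      _       = ⊤
PrefixMatch (_ ∷ _) []      = ⊥
PrefixMatch (p ∷ P) (t ∷ T) = CharMatch p t × PrefixMatch P T

Occurs : ∀ {k} → Pattern k → Text k → Set
Occurs P T = ∃[ j ] PrefixMatch P (drop j T)

-- A one-pass asymmetric streaming algorithm over alphabet Fin k that uses
-- b bits of memory (memory states Fin (2 ^ b)) and a random seed from
-- Fin R (public randomness, not counted as memory).  The text is available
-- by arbitrary random access, modelled by letting every component depend
-- on the whole text; the pattern is read once, symbol by symbol.
record StreamAlg (k b R : ℕ) : Set where
  field
    init : Fin R → Text k → Fin (2 ^ b)
    step : Fin R → Text k → Fin (2 ^ b) → Maybe (Fin k) → Fin (2 ^ b)
    out  : Fin R → Text k → Fin (2 ^ b) → Bool

run : ∀ {k b R} → StreamAlg k b R → Fin R → Text k → Pattern k → Bool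
run A r T P = StreamAlg.out A r T (foldl (StreamAlg.step A r T) (StreamAlg.init A r T) P)

CorrectOn : ∀ {k b R} → StreamAlg k b R → Fin R → Text k → Pattern k → Set
CorrectOn A r T P = (run A r T P ≡ true) ⇔ Occurs P T

-- correct with probability ≥ 2/3 over a uniformly random seed
-- (with R = 1 this is a deterministic algorithm that is always correct)
SolvesWHP : ∀ {k b R} → StreamAlg k b R → Text k → Pattern k → Set
SolvesWHP {R = R} A T P =
  Σ (Subset R) λ S → (2 * R ≤ 3 * ∣ S ∣) × (∀ r → r ∈ S → CorrectOn A r T P)

SolvesAllOfSize : ∀ {k b R} → StreamAlg k b R → ℕ → Set
SolvesAllOfSize {k} A n =
  (T : Text k) (P : Pattern k) → length T + length P ≡ n → SolvesWHP A T P

-- Reduction from the index problem.  For x ∈ {0,1}^m the streamed pattern is x written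
-- with a wildcard for 1 and the symbol 0 for 0, followed by a probe for position i; against
-- the text whose only ones sit at positions m and 2m+1 it occurs iff x_i = 1.  So the b-bit
-- memory state after the first half is a message from which each x_i is recovered with
-- probability 2/3, and averaging fixes a seed whose decoded guesses agree with x on 2/3 of
-- all pairs (x, i).  Weighting each agreement by 5 and each disagreement by 3, the vectors x
-- have total weight 8^m against any fixed guess, while an x agreeing in more than 5m/8 places
-- weighs at least 5^(5m/8) 3^(3m/8).  Comparing the two counts over the 2^b possible guesses
-- gives 2^m 5^(5m/8) 3^(3m/8) ≤ 9 · 2^b · 8^m, hence m = O(b), and the input has size Θ(m).

module Submission where

open import Data.Bool using (Bool; true; false)
open import Data.Fin using (Fin; zero; suc; toℕ)
open import Data.Fin.Patterns using (0F; 1F)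
open import Data.Fin.Properties using (any?; toℕ<n)
open import Data.Fin.Subset using (Subset; _∈_; ∣_∣)
open import Data.List using ([]; _∷_; _++_; drop; foldl; length; applyUpTo)
open import Data.List.Properties using (drop-drop; foldl-++; length-applyUpTo; length-++)
open import Data.Maybe using (Maybe; just; nothing)
open import Data.Nat
open import Data.Nat.DivMod using (_/_; _%_; m≡m%n+[m/n]*n; m%n<n)
open import Data.Nat.Properties
open import Data.Nat.Tactic.RingSolver using (solve-∀)
open import Data.Product using (∃-syntax; _×_; _,_; proj₁; proj₂)
open import Data.Sum using (_⊎_; inj₁; inj₂)
open import Data.Unit using (tt)
open import Data.Vec using (Vec; []; _∷_; lookup; tabulate; here; there)
open import Data.Vec.Functional using (Vector)
open import Data.Vec.Properties using (lookup∘tabulate)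
open import Function using (_∘_; Equivalence)
open import Relation.Binary.PropositionalEquality
open import Relation.Nullary using (yes; no; contradiction)

open import Algebra.Properties.Semiring.Sum +-*-semiring
  using (sum; sum-cong-≗; ∑-distrib-+; ∑-comm; *-distribˡ-sum)

open import Defs

sum-mono-≤ : ∀ {n} {f g : Vector ℕ n} → (∀ i → f i ≤ g i) → sum f ≤ sum g
sum-mono-≤ {zero}  _   = z≤n
sum-mono-≤ {suc n} f≤g = +-mono-≤ (f≤g zero) (sum-mono-≤ (f≤g ∘ suc))

sum-mono-< : ∀ {n} {f g : Vector ℕ (suc n)} → (∀ i → f i < g i) → sum f < sum g
sum-mono-< f<g = +-mono-<-≤ (f<g zero) (sum-mono-≤ (<⇒≤ ∘ f<g ∘ suc))

sum-const : ∀ n c → sum {n} (λ _ → c) ≡ n * c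
sum-const zero    c = refl
sum-const (suc n) c = cong (c +_) (sum-const n c)

≤-sum : ∀ {n} (f : Vector ℕ n) i → f i ≤ sum f
≤-sum f zero    = m≤m+n _ _
≤-sum f (suc i) = ≤-trans (≤-sum (f ∘ suc) i) (m≤n+m _ _)

∃-≥-average : ∀ {n} (f : Vector ℕ (suc n)) a → suc n * a ≤ sum f → ∃[ i ] a ≤ f i
∃-≥-average {n} f a total with any? (λ i → a ≤? f i)
... | yes large = large
... | no ¬large = contradiction total (<⇒≱ (subst (sum f <_) (sum-const (suc n) a)
                    (sum-mono-< (λ i → ≰⇒> (¬large ∘ (i ,_))))))

∣S∣≤sum : ∀ {n} (S : Subset n) (f : Vector ℕ n) → (∀ r → r ∈ S → 1 ≤ f r) → ∣ S ∣ ≤ sum f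
∣S∣≤sum []          f _    = z≤n
∣S∣≤sum (true ∷ S)  f 1≤f = +-mono-≤ (1≤f zero here) (∣S∣≤sum S (f ∘ suc) (λ r → 1≤f (suc r) ∘ there))
∣S∣≤sum (false ∷ S) f 1≤f = ≤-trans (∣S∣≤sum S (f ∘ suc) (λ r → 1≤f (suc r) ∘ there)) (m≤n+m _ _)

∑bits : ∀ m → (Vec Bool m → ℕ) → ℕ
∑bits zero    f = f []
∑bits (suc m) f = ∑bits m (f ∘ (true ∷_)) + ∑bits m (f ∘ (false ∷_))

∑bits-cong : ∀ m {f g : Vec Bool m → ℕ} → (∀ x → f x ≡ g x) → ∑bits m f ≡ ∑bits m g
∑bits-cong zero    f≡g = f≡g []
∑bits-cong (suc m) f≡g = cong₂ _+_ (∑bits-cong m (f≡g ∘ (true ∷_))) (∑bits-cong m (f≡g ∘ (false ∷_)))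

∑bits-mono-≤ : ∀ m {f g : Vec Bool m → ℕ} → (∀ x → f x ≤ g x) → ∑bits m f ≤ ∑bits m g
∑bits-mono-≤ zero    f≤g = f≤g []
∑bits-mono-≤ (suc m) f≤g = +-mono-≤ (∑bits-mono-≤ m (f≤g ∘ (true ∷_))) (∑bits-mono-≤ m (f≤g ∘ (false ∷_)))

∑bits-distrib-+ : ∀ m (f g : Vec Bool m → ℕ) → ∑bits m (λ x → f x + g x) ≡ ∑bits m f + ∑bits m g
∑bits-distrib-+ zero    f g = refl
∑bits-distrib-+ (suc m) f g = trans
  (cong₂ _+_ (∑bits-distrib-+ m (f ∘ (true ∷_)) (g ∘ (true ∷_)))
             (∑bits-distrib-+ m (f ∘ (false ∷_)) (g ∘ (false ∷_))))
  (+-interchange (∑bits m (f ∘ (true ∷_))) (∑bits m (g ∘ (true ∷_)))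
                 (∑bits m (f ∘ (false ∷_))) (∑bits m (g ∘ (false ∷_))))
  where
  +-interchange : ∀ a b c d → (a + b) + (c + d) ≡ (a + c) + (b + d)
  +-interchange = solve-∀

*-distribˡ-∑bits : ∀ m c (f : Vec Bool m → ℕ) → c * ∑bits m f ≡ ∑bits m (λ x → c * f x)
*-distribˡ-∑bits zero    c f = refl
*-distribˡ-∑bits (suc m) c f = trans (*-distribˡ-+ c _ _)
  (cong₂ _+_ (*-distribˡ-∑bits m c (f ∘ (true ∷_))) (*-distribˡ-∑bits m c (f ∘ (false ∷_))))

∑bits-const : ∀ m c → ∑bits m (λ _ → c) ≡ 2 ^ m * c
∑bits-const zero    c = sym (*-identityˡ c)
∑bits-const (suc m) c = trans (cong₂ _+_ (∑bits-const m c) (∑bits-const m c)) (double (2 ^ m) c)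
  where
  double : ∀ p c → p * c + p * c ≡ 2 * p * c
  double = solve-∀

∑bits-sum-comm : ∀ m {n} (F : Vec Bool m → Vector ℕ n) →
  ∑bits m (λ x → sum (F x)) ≡ sum (λ i → ∑bits m (λ x → F x i))
∑bits-sum-comm zero    F = refl
∑bits-sum-comm (suc m) F = trans
  (cong₂ _+_ (∑bits-sum-comm m (F ∘ (true ∷_))) (∑bits-sum-comm m (F ∘ (false ∷_))))
  (sym (∑-distrib-+ (λ i → ∑bits m (λ x → F (true ∷ x) i)) (λ i → ∑bits m (λ x → F (false ∷ x) i))))

^-distribʳ-* : ∀ a b n → (a * b) ^ n ≡ a ^ n * b ^ n
^-distribʳ-* a b zero    = refl
^-distribʳ-* a b (suc n) = trans (cong (a * b *_) (^-distribʳ-* a b n)) (shuffle a b (a ^ n) (b ^ n))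
  where
  shuffle : ∀ a b x y → a * b * (x * y) ≡ a * x * (b * y)
  shuffle = solve-∀

^-+-interchange : ∀ p q a b c d → p ^ (a + c) * q ^ (b + d) ≡ p ^ a * q ^ b * (p ^ c * q ^ d)
^-+-interchange p q a b c d = begin
  p ^ (a + c) * q ^ (b + d)           ≡⟨ cong₂ _*_ (^-distribˡ-+-* p a c) (^-distribˡ-+-* q b d) ⟩
  p ^ a * p ^ c * (q ^ b * q ^ d)     ≡⟨ shuffle (p ^ a) (p ^ c) (q ^ b) (q ^ d) ⟩
  p ^ a * q ^ b * (p ^ c * q ^ d)     ∎
  where
  open ≡-Reasoning
  shuffle : ∀ w x y z → w * x * (y * z) ≡ w * y * (x * z)
  shuffle = solve-∀

^-exchange-≤ : ∀ {p q} → p ≤ q → ∀ {u v a d} → u ≤ a → u + v ≡ a + d → q ^ u * p ^ v ≤ q ^ a * p ^ d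
^-exchange-≤ {p} {q} p≤q {u} {v} {d = d} u≤a u+v≡a+d with m≤n⇒∃[o]m+o≡n u≤a
... | t , refl = begin
  q ^ u * p ^ v              ≡⟨ cong (λ w → q ^ u * p ^ w) v≡t+d ⟩
  q ^ u * p ^ (t + d)        ≡⟨ cong (q ^ u *_) (^-distribˡ-+-* p t d) ⟩
  q ^ u * (p ^ t * p ^ d)    ≤⟨ *-monoʳ-≤ (q ^ u) (*-monoˡ-≤ (p ^ d) (^-monoˡ-≤ t p≤q)) ⟩
  q ^ u * (q ^ t * p ^ d)    ≡⟨ sym (*-assoc (q ^ u) (q ^ t) (p ^ d)) ⟩
  q ^ u * q ^ t * p ^ d      ≡⟨ cong (_* p ^ d) (sym (^-distribˡ-+-* q u t)) ⟩
  q ^ (u + t) * p ^ d        ∎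
  where
  open ≤-Reasoning
  v≡t+d : v ≡ t + d
  v≡t+d = +-cancelˡ-≡ u v (t + d) (trans u+v≡a+d (+-assoc u t d))

^-doubling : ∀ {x y k} → 2 * y ^ k ≤ x ^ k → y ≤ x → ∀ j t → 2 ^ j * y ^ (k * j + t) ≤ x ^ (k * j + t)
^-doubling {x} {y} {k} 2yᵏ≤xᵏ y≤x zero t =
  subst (λ z → 1 * y ^ z ≤ x ^ z) (sym (cong (_+ t) (*-zeroʳ k)))
    (subst (_≤ x ^ t) (sym (*-identityˡ (y ^ t))) (^-monoˡ-≤ t y≤x))
^-doubling {x} {y} {k} 2yᵏ≤xᵏ y≤x (suc j) t = begin
  2 * 2 ^ j * y ^ (k * suc j + t)       ≡⟨ cong (λ e → 2 * 2 ^ j * y ^ e) (unfold k j t) ⟩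
  2 * 2 ^ j * y ^ (k + (k * j + t))     ≡⟨ cong (2 * 2 ^ j *_) (^-distribˡ-+-* y k (k * j + t)) ⟩
  2 * 2 ^ j * (y ^ k * y ^ (k * j + t)) ≡⟨ shuffle 2 (2 ^ j) (y ^ k) (y ^ (k * j + t)) ⟩
  2 * y ^ k * (2 ^ j * y ^ (k * j + t)) ≤⟨ *-mono-≤ 2yᵏ≤xᵏ (^-doubling {k = k} 2yᵏ≤xᵏ y≤x j t) ⟩
  x ^ k * x ^ (k * j + t)               ≡⟨ sym (^-distribˡ-+-* x k (k * j + t)) ⟩
  x ^ (k + (k * j + t))                 ≡⟨ cong (x ^_) (sym (unfold k j t)) ⟩
  x ^ (k * suc j + t)                   ∎
  where
  open ≤-Reasoning
  unfold : ∀ k j t → k * suc j + t ≡ k + (k * j + t)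
  unfold = solve-∀
  shuffle : ∀ a b c d → a * b * (c * d) ≡ a * c * (b * d)
  shuffle = solve-∀

agree : Bool → Bool → ℕ
agree true  true  = 1
agree false false = 1
agree _     _     = 0

disagree : Bool → Bool → ℕ
disagree x y = 1 ∸ agree x y

agree+disagree : ∀ x y → agree x y + disagree x y ≡ 1
agree+disagree true  true  = refl
agree+disagree true  false = refl
agree+disagree false true  = refl
agree+disagree false false = refl

agree-≡1 : ∀ {a b} → (a ≡ true → b ≡ true) → (b ≡ true → a ≡ true) → agree a b ≡ 1
agree-≡1 {true}  {true}  _ _ = refl
agree-≡1 {false} {false} _ _ = refl
agree-≡1 {true}  {false} a⇒b _ = contradiction (a⇒b refl) λ ()
agree-≡1 {false} {true}  _ b⇒a = contradiction (b⇒a refl) λ ()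

agreements disagreements : ∀ {m} → Vec Bool m → Vec Bool m → ℕ
agreements    x y = sum (λ i → agree    (lookup x i) (lookup y i))
disagreements x y = sum (λ i → disagree (lookup x i) (lookup y i))

agreements+disagreements : ∀ {m} (x y : Vec Bool m) → agreements x y + disagreements x y ≡ m
agreements+disagreements {m} x y = begin
  agreements x y + disagreements x y                           ≡⟨ sym (∑-distrib-+ (λ i → agree (lookup x i) (lookup y i)) (λ i → disagree (lookup x i) (lookup y i))) ⟩
  sum (λ i → agree (lookup x i) (lookup y i) + disagree (lookup x i) (lookup y i))
                                                               ≡⟨ sum-cong-≗ (λ i → agree+disagree (lookup x i) (lookup y i)) ⟩
  sum {m} (λ _ → 1)                                            ≡⟨ sum-const m 1 ⟩
  m * 1                                                        ≡⟨ *-identityʳ m ⟩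
  m                                                            ∎
  where open ≡-Reasoning

agreements-≤ : ∀ {m} (x y : Vec Bool m) → agreements x y ≤ m
agreements-≤ x y = subst (agreements x y ≤_) (agreements+disagreements x y) (m≤m+n _ _)

weight : ∀ {m} → Vec Bool m → Vec Bool m → ℕ
weight x y = 5 ^ agreements x y * 3 ^ disagreements x y

bitWeight : Bool → Bool → ℕ
bitWeight x y = 5 ^ agree x y * 3 ^ disagree x y

weight-∷ : ∀ {m} x y (xs ys : Vec Bool m) → weight (x ∷ xs) (y ∷ ys) ≡ bitWeight x y * weight xs ys
weight-∷ x y xs ys = ^-+-interchange 5 3 (agree x y) (disagree x y) (agreements xs ys) (disagreements xs ys)

∑bits-weight : ∀ {m} (y : Vec Bool m) → ∑bits m (λ x → weight x y) ≡ 8 ^ m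
∑bits-weight []               = refl
∑bits-weight {suc m} (b ∷ y) = begin
  ∑bits m (λ x → weight (true ∷ x) (b ∷ y)) + ∑bits m (λ x → weight (false ∷ x) (b ∷ y))
    ≡⟨ cong₂ _+_ (∑bits-cong m (λ x → weight-∷ true b x y)) (∑bits-cong m (λ x → weight-∷ false b x y)) ⟩
  ∑bits m (λ x → bitWeight true b * weight x y) + ∑bits m (λ x → bitWeight false b * weight x y)
    ≡⟨ sym (cong₂ _+_ (*-distribˡ-∑bits m (bitWeight true b) (λ x → weight x y))
                      (*-distribˡ-∑bits m (bitWeight false b) (λ x → weight x y))) ⟩
  bitWeight true b * ∑bits m (λ x → weight x y) + bitWeight false b * ∑bits m (λ x → weight x y)
    ≡⟨ cong (λ z → bitWeight true b * z + bitWeight false b * z) (∑bits-weight y) ⟩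
  bitWeight true b * 8 ^ m + bitWeight false b * 8 ^ m
    ≡⟨ sym (*-distribʳ-+ (8 ^ m) (bitWeight true b) (bitWeight false b)) ⟩
  (bitWeight true b + bitWeight false b) * 8 ^ m
    ≡⟨ cong (_* 8 ^ m) (bitWeights b) ⟩
  8 * 8 ^ m ∎
  where
  open ≡-Reasoning
  bitWeights : ∀ b → bitWeight true b + bitWeight false b ≡ 8
  bitWeights true  = refl
  bitWeights false = refl

weight-≥ : ∀ {u v} (x y : Vec Bool (u + v)) → u ≤ agreements x y → 5 ^ u * 3 ^ v ≤ weight x y
weight-≥ x y u≤a = ^-exchange-≤ (≤ᵇ⇒≤ 3 5 _) u≤a (sym (agreements+disagreements x y))

-- Either x agrees with y in at most u places, or its weight is at least 5^u 3^v.
weighted-agreements-≤ : ∀ {u v} (x y : Vec Bool (u + v)) →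
  5 ^ u * 3 ^ v * agreements x y ≤ v * weight x y + u * (5 ^ u * 3 ^ v)
weighted-agreements-≤ {u} {v} x y with agreements x y ≤? u
... | yes a≤u = begin
  W₀ * agreements x y         ≤⟨ *-monoʳ-≤ W₀ a≤u ⟩
  W₀ * u                      ≡⟨ *-comm W₀ u ⟩
  u * W₀                      ≤⟨ m≤n+m _ _ ⟩
  v * weight x y + u * W₀     ∎
  where
  open ≤-Reasoning
  W₀ = 5 ^ u * 3 ^ v
... | no a≰u = begin
  W₀ * agreements x y         ≤⟨ *-monoʳ-≤ W₀ (agreements-≤ x y) ⟩
  W₀ * (u + v)                ≡⟨ split W₀ u v ⟩
  v * W₀ + u * W₀             ≤⟨ +-monoˡ-≤ (u * W₀) (*-monoʳ-≤ v (weight-≥ x y (<⇒≤ (≰⇒> a≰u)))) ⟩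
  v * weight x y + u * W₀     ∎
  where
  open ≤-Reasoning
  W₀ = 5 ^ u * 3 ^ v
  split : ∀ w u v → w * (u + v) ≡ v * w + u * w
  split = solve-∀

-- The randomized index lower bound

∑bits-weight-via-≤ : ∀ {m N} (encode : Vec Bool m → Fin N) (decode : Fin N → Vec Bool m) →
  ∑bits m (λ x → weight x (decode (encode x))) ≤ N * 8 ^ m
∑bits-weight-via-≤ {m} {N} encode decode = begin
  ∑bits m (λ x → weight x (decode (encode x)))
    ≤⟨ ∑bits-mono-≤ m (λ x → ≤-sum (λ c → weight x (decode c)) (encode x)) ⟩
  ∑bits m (λ x → sum (λ c → weight x (decode c)))
    ≡⟨ ∑bits-sum-comm m (λ x c → weight x (decode c)) ⟩
  sum (λ c → ∑bits m (λ x → weight x (decode c)))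
    ≡⟨ sum-cong-≗ (∑bits-weight ∘ decode) ⟩
  sum {N} (λ _ → 8 ^ m)
    ≡⟨ sum-const N (8 ^ m) ⟩
  N * 8 ^ m ∎
  where open ≤-Reasoning

compression-bound : ∀ {u v N} (encode : Vec Bool (u + v) → Fin N) (decode : Fin N → Vec Bool (u + v)) →
  5 ^ u * 3 ^ v * ∑bits (u + v) (λ x → agreements x (decode (encode x)))
    ≤ v * (N * 8 ^ (u + v)) + 2 ^ (u + v) * (u * (5 ^ u * 3 ^ v))
compression-bound {u} {v} {N} encode decode = begin
  W₀ * ∑bits m (λ x → agreements x (guess x))
    ≡⟨ *-distribˡ-∑bits m W₀ (λ x → agreements x (guess x)) ⟩
  ∑bits m (λ x → W₀ * agreements x (guess x))
    ≤⟨ ∑bits-mono-≤ m (λ x → weighted-agreements-≤ {u} x (guess x)) ⟩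
  ∑bits m (λ x → v * weight x (guess x) + u * W₀)
    ≡⟨ ∑bits-distrib-+ m (λ x → v * weight x (guess x)) (λ _ → u * W₀) ⟩
  ∑bits m (λ x → v * weight x (guess x)) + ∑bits m (λ _ → u * W₀)
    ≡⟨ cong₂ _+_ (sym (*-distribˡ-∑bits m v (λ x → weight x (guess x)))) (∑bits-const m (u * W₀)) ⟩
  v * ∑bits m (λ x → weight x (guess x)) + 2 ^ m * (u * W₀)
    ≤⟨ +-monoˡ-≤ _ (*-monoʳ-≤ v (∑bits-weight-via-≤ encode decode)) ⟩
  v * (N * 8 ^ m) + 2 ^ m * (u * W₀) ∎
  where
  open ≤-Reasoning
  m = u + v
  W₀ = 5 ^ u * 3 ^ v
  guess = decode ∘ encode

∃-good-seed : ∀ {R m} (guess : Fin (suc R) → Vec Bool m → Vec Bool m) →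
  (∀ x i → 2 * suc R ≤ 3 * sum (λ r → agree (lookup x i) (lookup (guess r x) i))) →
  ∃[ r ] 2 * m * 2 ^ m ≤ 3 * ∑bits m (λ x → agreements x (guess r x))
∃-good-seed {R} {m} guess often-right = ∃-≥-average (λ r → 3 * A r) (2 * m * 2 ^ m) total
  where
  open ≤-Reasoning
  F : Fin (suc R) → Vec Bool m → Fin m → ℕ
  F r x i = agree (lookup x i) (lookup (guess r x) i)
  A : Fin (suc R) → ℕ
  A r = ∑bits m (λ x → agreements x (guess r x))
  rearrange : ∀ R m p → R * (2 * m * p) ≡ p * (m * (2 * R))
  rearrange = solve-∀
  total : suc R * (2 * m * 2 ^ m) ≤ sum (λ r → 3 * A r)
  total = begin
    suc R * (2 * m * 2 ^ m)
      ≡⟨ rearrange (suc R) m (2 ^ m) ⟩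
    2 ^ m * (m * (2 * suc R))
      ≡⟨ sym (trans (∑bits-const m _) (cong (2 ^ m *_) (sum-const m (2 * suc R)))) ⟩
    ∑bits m (λ x → sum {m} (λ i → 2 * suc R))
      ≤⟨ ∑bits-mono-≤ m (λ x → sum-mono-≤ (often-right x)) ⟩
    ∑bits m (λ x → sum (λ i → 3 * sum (λ r → F r x i)))
      ≡⟨ ∑bits-cong m (λ x → sym (*-distribˡ-sum 3 (λ i → sum (λ r → F r x i)))) ⟩
    ∑bits m (λ x → 3 * sum (λ i → sum (λ r → F r x i)))
      ≡⟨ sym (*-distribˡ-∑bits m 3 _) ⟩
    3 * ∑bits m (λ x → sum (λ i → sum (λ r → F r x i)))
      ≡⟨ cong (3 *_) (∑bits-cong m (λ x → ∑-comm (λ i r → F r x i))) ⟩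
    3 * ∑bits m (λ x → sum (λ r → agreements x (guess r x)))
      ≡⟨ cong (3 *_) (∑bits-sum-comm m (λ x r → agreements x (guess r x))) ⟩
    3 * sum A
      ≡⟨ *-distribˡ-sum 3 A ⟩
    sum (λ r → 3 * A r) ∎

index-lower-bound : ∀ {u v N R} (encode : Fin (suc R) → Vec Bool (u + v) → Fin N)
  (decode : Fin (suc R) → Fin N → Vec Bool (u + v)) →
  (∀ x i → 2 * suc R ≤ 3 * sum (λ r → agree (lookup x i) (lookup (decode r (encode r x)) i))) →
  2 * (u + v) * (2 ^ (u + v) * (5 ^ u * 3 ^ v))
    ≤ 3 * u * (2 ^ (u + v) * (5 ^ u * 3 ^ v)) + 3 * v * (N * 8 ^ (u + v))
index-lower-bound {u} {v} {N} encode decode often-right = begin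
  2 * m * (2 ^ m * W₀)                        ≡⟨ shuffle m (2 ^ m) W₀ ⟩
  W₀ * (2 * m * 2 ^ m)                        ≤⟨ *-monoʳ-≤ W₀ good ⟩
  W₀ * (3 * A)                                ≡⟨ x*[y*z]≡y*[x*z] W₀ 3 A ⟩
  3 * (W₀ * A)                                ≤⟨ *-monoʳ-≤ 3 (compression-bound {u} (encode r) (decode r)) ⟩
  3 * (v * (N * 8 ^ m) + 2 ^ m * (u * W₀))    ≡⟨ distribute u v (N * 8 ^ m) (2 ^ m) W₀ ⟩
  3 * u * (2 ^ m * W₀) + 3 * v * (N * 8 ^ m)  ∎
  where
  open ≤-Reasoning
  m = u + v
  W₀ = 5 ^ u * 3 ^ v
  seed = ∃-good-seed (λ r → decode r ∘ encode r) often-right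
  r = proj₁ seed
  good = proj₂ seed
  A = ∑bits m (λ x → agreements x (decode r (encode r x)))
  shuffle : ∀ m p w → 2 * m * (p * w) ≡ w * (2 * m * p)
  shuffle = solve-∀
  x*[y*z]≡y*[x*z] : ∀ x y z → x * (y * z) ≡ y * (x * z)
  x*[y*z]≡y*[x*z] = solve-∀
  distribute : ∀ u v y p w → 3 * (v * y + p * (u * w)) ≡ 3 * u * (p * w) + 3 * v * y
  distribute = solve-∀

-- With m = 8s, u = 5s, v = 3s one has 2^m 5^u 3^v = D^s and 8^m = B^s; all that matters is D³ ≥ 2 B³.
D B : ℕ
D = 2 ^ 8 * (5 ^ 5 * 3 ^ 3)
B = 8 ^ 8

growth-bound : ∀ s b → D ^ s ≤ 9 * (2 ^ b * B ^ s) → s < 3 * b + 12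
growth-bound s b Dˢ≤ with s <? 3 * b + 12
... | yes s< = s<
... | no s≮ = contradiction (*-cancelʳ-≤ 16 9 Z (≤-trans 16Z≤Dˢ Dˢ≤)) (<⇒≱ (m≤m+n 10 6))
  where
  open ≤-Reasoning
  j = 4 + b
  t = s ∸ 3 * j
  Z = 2 ^ b * B ^ s
  instance
    Z≢0 : NonZero Z
    Z≢0 = >-nonZero (*-mono-< (m^n>0 2 b) (m^n>0 B s))
  s≡ : 3 * j + t ≡ s
  s≡ = m+[n∸m]≡n (subst (_≤ s) (regroup b) (≮⇒≥ s≮))
    where
    regroup : ∀ b → 3 * b + 12 ≡ 3 * (4 + b)
    regroup = solve-∀
  16Z≤Dˢ : 16 * Z ≤ D ^ s
  16Z≤Dˢ = begin
    16 * (2 ^ b * B ^ s)           ≡⟨ sym (*-assoc 16 (2 ^ b) (B ^ s)) ⟩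
    16 * 2 ^ b * B ^ s             ≡⟨ cong (_* B ^ s) (sym (^-distribˡ-+-* 2 4 b)) ⟩
    2 ^ j * B ^ s                  ≡⟨ cong (λ e → 2 ^ j * B ^ e) (sym s≡) ⟩
    2 ^ j * B ^ (3 * j + t)        ≤⟨ ^-doubling {D} {B} {3} (≤ᵇ⇒≤ (2 * B ^ 3) (D ^ 3) _) (≤ᵇ⇒≤ B D _) j t ⟩
    D ^ (3 * j + t)                ≡⟨ cong (D ^_) s≡ ⟩
    D ^ s                          ∎

5s+3s≡8s : ∀ s → 5 * s + 3 * s ≡ 8 * s
5s+3s≡8s = solve-∀

Dˢ≡ : ∀ s → 2 ^ (5 * s + 3 * s) * (5 ^ (5 * s) * 3 ^ (3 * s)) ≡ D ^ s
Dˢ≡ s = begin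
  2 ^ (5 * s + 3 * s) * (5 ^ (5 * s) * 3 ^ (3 * s))
    ≡⟨ cong (λ e → 2 ^ e * (5 ^ (5 * s) * 3 ^ (3 * s))) (5s+3s≡8s s) ⟩
  2 ^ (8 * s) * (5 ^ (5 * s) * 3 ^ (3 * s))
    ≡⟨ sym (cong₂ _*_ (^-*-assoc 2 8 s) (cong₂ _*_ (^-*-assoc 5 5 s) (^-*-assoc 3 3 s))) ⟩
  (2 ^ 8) ^ s * ((5 ^ 5) ^ s * (3 ^ 3) ^ s)
    ≡⟨ sym (cong ((2 ^ 8) ^ s *_) (^-distribʳ-* (5 ^ 5) (3 ^ 3) s)) ⟩
  (2 ^ 8) ^ s * (5 ^ 5 * 3 ^ 3) ^ s
    ≡⟨ sym (^-distribʳ-* (2 ^ 8) (5 ^ 5 * 3 ^ 3) s) ⟩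
  D ^ s ∎
  where open ≡-Reasoning

Bˢ≡ : ∀ s → 8 ^ (5 * s + 3 * s) ≡ B ^ s
Bˢ≡ s = trans (cong (8 ^_) (5s+3s≡8s s)) (sym (^-*-assoc 8 8 s))

message-bound : ∀ s b →
  let X = 2 ^ (5 * s + 3 * s) * (5 ^ (5 * s) * 3 ^ (3 * s)) in
  2 * (5 * s + 3 * s) * X ≤ 3 * (5 * s) * X + 3 * (3 * s) * (2 ^ b * 8 ^ (5 * s + 3 * s)) →
  s < 3 * b + 12
message-bound zero    b _        = ≤-trans (s≤s z≤n) (m≤n+m 12 (3 * b))
message-bound (suc s') b tradeoff = growth-bound s b
  (subst₂ (λ X Y → X ≤ 9 * (2 ^ b * Y)) (Dˢ≡ s) (Bˢ≡ s)
    (*-cancelˡ-≤ s (+-cancelʳ-≤ (15 * (s * X)) (s * X) (s * (9 * Y))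
      (subst₂ _≤_ (lhs s X) (rhs s X Y) tradeoff))))
  where
  s = suc s'
  X = 2 ^ (5 * s + 3 * s) * (5 ^ (5 * s) * 3 ^ (3 * s))
  Y = 2 ^ b * 8 ^ (5 * s + 3 * s)
  lhs : ∀ s X → 2 * (5 * s + 3 * s) * X ≡ s * X + 15 * (s * X)
  lhs = solve-∀
  rhs : ∀ s X Y → 3 * (5 * s) * X + 3 * (3 * s) * Y ≡ s * (9 * Y) + 15 * (s * X)
  rhs = solve-∀

drop-applyUpTo : ∀ {A : Set} j (f : ℕ → A) L → drop j (applyUpTo f L) ≡ applyUpTo (f ∘ (j +_)) (L ∸ j)
drop-applyUpTo zero    f L       = refl
drop-applyUpTo (suc j) f zero    = refl
drop-applyUpTo (suc j) f (suc L) = drop-applyUpTo j (f ∘ suc) L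

module _ {k : ℕ} where

  PrefixMatch-++⁻ : ∀ (P Q : Pattern k) T → PrefixMatch (P ++ Q) T →
    PrefixMatch P T × PrefixMatch Q (drop (length P) T)
  PrefixMatch-++⁻ []      Q T       match = tt , match
  PrefixMatch-++⁻ (p ∷ P) Q (t ∷ T) (p≈t , match) =
    let (P≈ , Q≈) = PrefixMatch-++⁻ P Q T match in (p≈t , P≈) , Q≈

  PrefixMatch-++⁺ : ∀ (P Q : Pattern k) T → PrefixMatch P T → PrefixMatch Q (drop (length P) T) →
    PrefixMatch (P ++ Q) T
  PrefixMatch-++⁺ []      Q T       _           Q≈ = Q≈
  PrefixMatch-++⁺ (p ∷ P) Q (t ∷ T) (p≈t , P≈) Q≈ = p≈t , PrefixMatch-++⁺ P Q T P≈ Q≈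

  PrefixMatch-applyUpTo⁻ : ∀ {a L} (f : ℕ → Maybe (Fin k)) (g : ℕ → Fin k) →
    PrefixMatch (applyUpTo f a) (applyUpTo g L) → ∀ t → t < a → CharMatch (f t) (g t)
  PrefixMatch-applyUpTo⁻ {suc a} {suc L} f g (f0≈g0 , _)     zero    _         = f0≈g0
  PrefixMatch-applyUpTo⁻ {suc a} {suc L} f g (_     , match) (suc t) (s≤s t<a) =
    PrefixMatch-applyUpTo⁻ (f ∘ suc) (g ∘ suc) match t t<a

  PrefixMatch-applyUpTo⁺ : ∀ {a L} (f : ℕ → Maybe (Fin k)) (g : ℕ → Fin k) → a ≤ L →
    (∀ t → t < a → CharMatch (f t) (g t)) → PrefixMatch (applyUpTo f a) (applyUpTo g L)
  PrefixMatch-applyUpTo⁺ {zero}          f g _         _    = tt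
  PrefixMatch-applyUpTo⁺ {suc a} {suc L} f g (s≤s a≤L) f≈g =
    f≈g zero z<s , PrefixMatch-applyUpTo⁺ (f ∘ suc) (g ∘ suc) a≤L (λ t t<a → f≈g (suc t) (s<s t<a))

-- Encoding the index problem

textLength : ℕ → ℕ → ℕ
textLength m e = m + m + suc (m + e)

module IndexReduction {k : ℕ} where

  marker : ℕ → ℕ → Fin (2 + k)
  marker m u with u ≟ m | u ≟ suc (m + m)
  ... | yes _ | _     = 1F
  ... | no _  | yes _ = 1F
  ... | no _  | no _  = 0F

  marker-≡1F : ∀ m u → marker m u ≡ 1F → u ≡ m ⊎ u ≡ suc (m + m)
  marker-≡1F m u _  with u ≟ m | u ≟ suc (m + m)
  marker-≡1F m u _  | yes u≡m | _            = inj₁ u≡m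
  marker-≡1F m u _  | no _    | yes u≡2m+1   = inj₂ u≡2m+1
  marker-≡1F m u () | no _    | no _

  marker-first : ∀ m → marker m m ≡ 1F
  marker-first m with m ≟ m
  ... | yes _   = refl
  ... | no m≢m = contradiction refl m≢m

  marker-second : ∀ m → marker m (suc (m + m)) ≡ 1F
  marker-second m with suc (m + m) ≟ m | suc (m + m) ≟ suc (m + m)
  ... | yes _ | _       = refl
  ... | no _  | yes _   = refl
  ... | no _  | no ne   = contradiction refl ne

  marker-elsewhere : ∀ m u → u ≢ m → u ≢ suc (m + m) → marker m u ≡ 0F
  marker-elsewhere m u u≢m u≢2m+1 with u ≟ m | u ≟ suc (m + m)
  ... | yes u≡m | _          = contradiction u≡m u≢m
  ... | no _    | yes u≡2m+1 = contradiction u≡2m+1 u≢2m+1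
  ... | no _    | no _       = refl

  indexText : ℕ → ℕ → Text (2 + k)
  indexText m e = applyUpTo (marker m) (textLength m e)

  wildcardIf : Bool → Maybe (Fin (2 + k))
  wildcardIf true  = nothing
  wildcardIf false = just 0F

  -- Junk value false beyond the length of the vector.
  bitAt : ∀ {m} → Vec Bool m → ℕ → Bool
  bitAt []      _       = false
  bitAt (b ∷ _) zero    = b
  bitAt (_ ∷ x) (suc t) = bitAt x t

  bitAt-toℕ : ∀ {m} (x : Vec Bool m) i → bitAt x (toℕ i) ≡ lookup x i
  bitAt-toℕ (_ ∷ _) zero    = refl
  bitAt-toℕ (_ ∷ x) (suc i) = bitAt-toℕ x i

  encodeBits : ∀ {m} → Vec Bool m → Pattern (2 + k)
  encodeBits {m} x = applyUpTo (wildcardIf ∘ bitAt x) m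

  probeAt : ℕ → ℕ → Maybe (Fin (2 + k))
  probeAt i t with t ≟ suc i
  ... | yes _ = just 1F
  ... | no _  = nothing

  probeAt-hit : ∀ i → probeAt i (suc i) ≡ just 1F
  probeAt-hit i with suc i ≟ suc i
  ... | yes _ = refl
  ... | no ne = contradiction refl ne

  probe : ℕ → ℕ → Pattern (2 + k)
  probe m i = applyUpTo (probeAt i) (suc m)

  -- An occurrence must put the probe's 1 on the second marker, which puts bit i on the first.
  query : ∀ {m} → Vec Bool m → ℕ → Pattern (2 + k)
  query {m} x i = encodeBits x ++ probe m i

  probe-position : ∀ j m i → j + m + suc i ≡ suc (m + (j + i))
  probe-position = solve-∀

  drop-bits : ∀ {m} e j (x : Vec Bool m) →
    drop (length (encodeBits x)) (drop j (indexText m e))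
      ≡ applyUpTo (marker m ∘ (j + m +_)) (textLength m e ∸ (j + m))
  drop-bits {m} e j x = begin
    drop (length (encodeBits x)) (drop j (indexText m e)) ≡⟨ cong (λ l → drop l (drop j (indexText m e))) (length-applyUpTo _ m) ⟩
    drop m (drop j (indexText m e))                        ≡⟨ drop-drop j m (indexText m e) ⟩
    drop (j + m) (indexText m e)                           ≡⟨ drop-applyUpTo (j + m) (marker m) (textLength m e) ⟩
    applyUpTo (marker m ∘ (j + m +_)) (textLength m e ∸ (j + m)) ∎
    where open ≡-Reasoning

  just-matches : ∀ {a b : Fin (2 + k)} → CharMatch (just a) b → a ≡ b
  just-matches (inj₂ refl) = refl

  wildcardIf-matches-0F : ∀ b → CharMatch (wildcardIf b) 0F
  wildcardIf-matches-0F true  = inj₁ refl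
  wildcardIf-matches-0F false = inj₂ refl

  wildcardIf-matches-1F : ∀ {b} → CharMatch (wildcardIf b) 1F → b ≡ true
  wildcardIf-matches-1F {true} _ = refl
  wildcardIf-matches-1F {false} (inj₂ ())

  occurs⇒bit : ∀ {m} e (x : Vec Bool m) {i} → i < m → Occurs (query x i) (indexText m e) → bitAt x i ≡ true
  occurs⇒bit {m} e x {i} i<m (j , match) =
    wildcardIf-matches-1F (subst (CharMatch _) (trans (cong (marker m) j+i≡m) (marker-first m)) bit-matches)
    where
    parts = PrefixMatch-++⁻ (encodeBits x) (probe m i) (drop j (indexText m e)) match
    bit-matches : CharMatch (wildcardIf (bitAt x i)) (marker m (j + i))
    bit-matches = PrefixMatch-applyUpTo⁻ (wildcardIf ∘ bitAt x) (marker m ∘ (j +_))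
      (subst (PrefixMatch (encodeBits x)) (drop-applyUpTo j (marker m) (textLength m e)) (proj₁ parts)) i i<m
    probe-matches : CharMatch (probeAt i (suc i)) (marker m (j + m + suc i))
    probe-matches = PrefixMatch-applyUpTo⁻ (probeAt i) (marker m ∘ (j + m +_))
      (subst (PrefixMatch (probe m i)) (drop-bits e j x) (proj₂ parts)) (suc i) (s≤s i<m)
    j+i≡m : j + i ≡ m
    j+i≡m with marker-≡1F m _ (sym (just-matches (subst (λ p → CharMatch p (marker m (j + m + suc i))) (probeAt-hit i) probe-matches)))
    ... | inj₁ at-first  = contradiction (trans (sym at-first) (probe-position j m i)) (m≢1+m+n m)
    ... | inj₂ at-second = +-cancelˡ-≡ m (j + i) m (suc-injective (trans (sym (probe-position j m i)) at-second))

  bit⇒occurs : ∀ {m} e (x : Vec Bool m) {i} → i < m → bitAt x i ≡ true → Occurs (query x i) (indexText m e)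
  bit⇒occurs {m} e x {i} i<m xᵢ = j , PrefixMatch-++⁺ (encodeBits x) (probe m i) (drop j (indexText m e))
    (subst (PrefixMatch (encodeBits x)) (sym (drop-applyUpTo j (marker m) (textLength m e)))
      (PrefixMatch-applyUpTo⁺ (wildcardIf ∘ bitAt x) (marker m ∘ (j +_))
        (≤-trans (n≤1+n m) (room j j≤m+m)) bits-match))
    (subst (PrefixMatch (probe m i)) (sym (drop-bits e j x))
      (PrefixMatch-applyUpTo⁺ (probeAt i) (marker m ∘ (j + m +_)) (room (j + m) (+-monoˡ-≤ m j≤m)) probe-match))
    where
    j = m ∸ i
    j+i≡m : j + i ≡ m
    j+i≡m = m∸n+n≡m (<⇒≤ i<m)
    j≤m : j ≤ m
    j≤m = m∸n≤m m i
    j≤m+m : j ≤ m + m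
    j≤m+m = ≤-trans j≤m (m≤m+n m m)
    room : ∀ d → d ≤ m + m → suc m ≤ textLength m e ∸ d
    room d d≤m+m = ≤-trans (s≤s (m≤m+n m e))
      (≤-trans (≤-reflexive (sym (m+n∸m≡n (m + m) (suc (m + e))))) (∸-monoʳ-≤ (textLength m e) d≤m+m))
    bits-match : ∀ t → t < m → CharMatch (wildcardIf (bitAt x t)) (marker m (j + t))
    bits-match t t<m with t ≟ i
    ... | yes refl = inj₁ (cong wildcardIf xᵢ)
    ... | no t≢i   = subst (CharMatch _) (sym (marker-elsewhere m (j + t) j+t≢m j+t≢2m+1)) (wildcardIf-matches-0F _)
      where
      j+t≢m : j + t ≢ m
      j+t≢m j+t≡m = t≢i (+-cancelˡ-≡ j t i (trans j+t≡m (sym j+i≡m)))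
      j+t≢2m+1 : j + t ≢ suc (m + m)
      j+t≢2m+1 = <⇒≢ (s≤s (+-mono-≤ j≤m (<⇒≤ t<m)))
    probe-match : ∀ t → t < suc m → CharMatch (probeAt i t) (marker m (j + m + t))
    probe-match t _ with t ≟ suc i
    ... | yes refl = inj₂ (cong just (sym (trans
                       (cong (marker m) (trans (probe-position j m i) (cong (λ l → suc (m + l)) j+i≡m)))
                       (marker-second m))))
    ... | no _     = inj₁ refl

-- The memory state after the encoded bits is a message from which every bit can be
-- recovered by continuing the stream with the corresponding probe.
module StreamingIndex {k b R} (A : StreamAlg (2 + k) b (suc R)) (m e : ℕ) where
  open StreamAlg A
  open IndexReduction {k}

  text : Text (2 + k)
  text = indexText m e

  encode : Fin (suc R) → Vec Bool m → Fin (2 ^ b)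
  encode r x = foldl (step r text) (init r text) (encodeBits x)

  decode : Fin (suc R) → Fin (2 ^ b) → Vec Bool m
  decode r st = tabulate (λ i → out r text (foldl (step r text) st (probe m (toℕ i))))

  decode∘encode : ∀ r x i → lookup (decode r (encode r x)) i ≡ run A r text (query x (toℕ i))
  decode∘encode r x i = trans (lookup∘tabulate _ i)
    (sym (cong (out r text) (foldl-++ (step r text) (init r text) (encodeBits x) (probe m (toℕ i)))))

  correct⇒agree : ∀ r x i → CorrectOn A r text (query x (toℕ i)) → agree (lookup x i) (lookup (decode r (encode r x)) i) ≡ 1
  correct⇒agree r x i correct = subst (λ y → agree (lookup x i) y ≡ 1) (sym (decode∘encode r x i))
    (agree-≡1
      (λ xᵢ → Equivalence.from correct (bit⇒occurs e x (toℕ<n i) (trans (bitAt-toℕ x i) xᵢ)))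
      (λ answer → trans (sym (bitAt-toℕ x i)) (occurs⇒bit e x (toℕ<n i) (Equivalence.to correct answer))))

  instanceSize : ℕ
  instanceSize = textLength m e + (m + suc m)

  query-size : ∀ (x : Vec Bool m) i → length text + length (query x i) ≡ instanceSize
  query-size x i = cong₂ _+_ (length-applyUpTo (marker m) (textLength m e))
    (trans (length-++ (encodeBits x))
      (cong₂ _+_ (length-applyUpTo (wildcardIf ∘ bitAt x) m) (length-applyUpTo (probeAt i) (suc m))))

  often-right : SolvesAllOfSize A instanceSize →
    ∀ x i → 2 * suc R ≤ 3 * sum (λ r → agree (lookup x i) (lookup (decode r (encode r x)) i))
  often-right solves x i with solves text (query x (toℕ i)) (query-size x (toℕ i))
  ... | S , 2R≤3∣S∣ , correct = ≤-trans 2R≤3∣S∣ (*-monoʳ-≤ 3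
        (∣S∣≤sum S _ (λ r r∈S → ≤-reflexive (sym (correct⇒agree r x i (correct r r∈S))))))

size-bound : ∀ n s e b → n ≡ 2 + (e + s * 40) → e < 40 → s < 3 * b + 12 → 482 ≤ n → n ≤ 601 * b
size-bound n s e b refl e<40 s<3b+12 482≤n = ≤-trans n≤ (linear b (≤-trans 482≤n n≤))
  where
  open ≤-Reasoning
  affine : ∀ b → 2 + (39 + (3 * b + 11) * 40) ≡ 481 + 120 * b
  affine = solve-∀
  n≤ : 2 + (e + s * 40) ≤ 481 + 120 * b
  n≤ = begin
    2 + (e + s * 40)                ≤⟨ +-monoʳ-≤ 2 (+-mono-≤ (≤-pred e<40)
                                         (*-monoˡ-≤ 40 (≤-pred (subst (suc s ≤_) (+-suc (3 * b) 11) s<3b+12)))) ⟩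
    2 + (39 + (3 * b + 11) * 40)    ≡⟨ affine b ⟩
    481 + 120 * b                   ∎
  linear : ∀ b → 482 ≤ 481 + 120 * b → 481 + 120 * b ≤ 601 * b
  linear zero    482≤481 = contradiction 482≤481 (<-irrefl refl)
  linear (suc b) _       = subst₂ _≤_ (sym (lhs b)) (sym (rhs b)) (+-monoʳ-≤ 601 (*-monoˡ-≤ b (m≤m+n 120 481)))
    where
    lhs : ∀ b → 481 + 120 * suc b ≡ 601 + 120 * b
    lhs = solve-∀
    rhs : ∀ b → 601 * suc b ≡ 601 + 601 * b
    rhs = solve-∀

theorem2 : (k : ℕ) → 2 ≤ k →
    ∃[ c ] ∃[ N ] ((n : ℕ) → N ≤ n → (b R : ℕ) → 1 ≤ R →
      (A : StreamAlg k b R) → SolvesAllOfSize A n → n ≤ c * b)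
theorem2 (suc zero)    (s≤s ())
theorem2 (suc (suc k)) _ = 601 , 482 , bound
  where
  bound : (n : ℕ) → 482 ≤ n → (b R : ℕ) → 1 ≤ R → (A : StreamAlg (2 + k) b R) → SolvesAllOfSize A n → n ≤ 601 * b
  bound n 482≤n b zero    () A solves
  bound n 482≤n b (suc R) _  A solves = size-bound n s e b n≡ (m%n<n (n ∸ 2) 40) s<3b+12 482≤n
    where
    s = (n ∸ 2) / 40
    e = (n ∸ 2) % 40
    open StreamingIndex A (5 * s + 3 * s) e
    n≡ : n ≡ 2 + (e + s * 40)
    n≡ = trans (sym (m+[n∸m]≡n (≤-trans (m≤m+n 2 480) 482≤n))) (cong (2 +_) (m≡m%n+[m/n]*n (n ∸ 2) 40))
    shape : ∀ s e → let m = 5 * s + 3 * s in 2 + (e + s * 40) ≡ m + m + suc (m + e) + (m + suc m)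
    shape = solve-∀
    s<3b+12 : s < 3 * b + 12
    s<3b+12 = message-bound s b (index-lower-bound {5 * s} {3 * s} encode decode
      (often-right (subst (SolvesAllOfSize A) (trans n≡ (shape s e)) solves)))
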